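{- Let $r\ge 2$ and $n$ be integers with $n>f(r)$, where $$f(r)=\begin{cases}\max\left\{\frac{r+7}{2},\ \frac{r^2+4r+3}{8}\right\}, & \text{if } r\ge 3 \text{ is odd},\\[4pt] \max\left\{\frac{r^2+2r}{8},\ \frac{r+8}{2},\ \frac{r^2+6r+12}{12}\right\}, & \text{if } r\ge 2 \text{ is even}.\end{cases}$$ Then $\kappa(Q_n;K_{1,r})=\kappa^s(Q_n;K_{1,r})=\lceil \frac{n}{2}\rceil$.
   Context: The $n$-dimensional hypercube $Q_n$ has as vertices all binary strings of length $n$, two strings being adjacent iff they differ in exactly one position. $K_{1,r}$ denotes the star with $r$ leaves. For a graph $G$ and a set $F$ of subgraphs of $G$, $G-F$ denotes the graph obtained from $G$ by deleting all vertices of all members of $F$. For a connected graph $T$, the $T$-structure connectivity $\kappa(G;T)$ is the minimum cardinality of a set $F$ of subgraphs of $G$, each isomorphic to $T$, such that $G-F$ is disconnected. The $T$-substructure connectivity $\kappa^s(G;T)$ is the minimum cardinality of a set $F$ of subgraphs of $G$, each isomorphic to a connected subgraph of $T$, such that $G-F$ is disconnected. -}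

module Defs where

open import Data.Nat using (ℕ; _+_; _*_; _≤_; _<_; _%_; ⌈_/2⌉)
open import Data.Bool using (Bool)
open import Data.Fin using (Fin)
open import Data.Vec using (Vec; lookup)
open import Data.Product using (Σ; _×_; ∃)
open import Data.Sum using (_⊎_)
open import Relation.Binary.PropositionalEquality using (_≡_; _≢_)
open import Relation.Nullary using (¬_)
open import Function.Definitions using (Injective)

Vertex : ℕ → Set
Vertex n = Vec Bool n

Adj : {n : ℕ} → Vertex n → Vertex n → Set
Adj {n} u v = Σ (Fin n) λ i → (lookup u i ≢ lookup v i) × (∀ j → j ≢ i → lookup u j ≡ lookup v j)

-- A subgraph of Q_n isomorphic to the star K_{1,s}: a centre and s distinct
-- leaves, each adjacent (in Q_n) to the centre.  (K_{1,0} is a single vertex.)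
record Star (n s : ℕ) : Set where
  field
    centre : Vertex n
    leaf   : Fin s → Vertex n
    leaf-inj : Injective _≡_ _≡_ leaf
    leaf-adj : ∀ j → Adj centre (leaf j)

InStar : {n s : ℕ} → Star n s → Vertex n → Set
InStar S x = Star.centre S ≡ x ⊎ ∃ λ j → Star.leaf S j ≡ x

-- A subgraph of Q_n isomorphic to a connected subgraph of K_{1,r}:
-- the connected subgraphs of K_{1,r} are exactly K_{1,s}, 0 ≤ s ≤ r.
record SubStar (n r : ℕ) : Set where
  field
    size : ℕ
    size≤ : size ≤ r
    star : Star n size

InSubStar : {n r : ℕ} → SubStar n r → Vertex n → Set
InSubStar S x = InStar (SubStar.star S) x

data Reach {n : ℕ} (P : Vertex n → Set) : Vertex n → Vertex n → Set where
  here : ∀ {u} → Reach P u u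
  step : ∀ {u v w} → Reach P u v → Adj v w → P w → Reach P u w

Disconnected : {n : ℕ} → (Vertex n → Set) → Set
Disconnected {n} X =
  Σ (Vertex n) λ u → Σ (Vertex n) λ v →
    ¬ X u × ¬ X v × ¬ Reach (λ w → ¬ X w) u v

-- A family of k stars K_{1,r} whose deletion disconnects Q_n.
-- (Families are indexed by Fin k; repetitions only increase k, so the
-- minimum over indexed families equals the minimum over sets.)
StarCut : (n r k : ℕ) → Set
StarCut n r k = Σ (Fin k → Star n r) λ F →
  Disconnected (λ x → ∃ λ i → InStar (F i) x)

SubStarCut : (n r k : ℕ) → Set
SubStarCut n r k = Σ (Fin k → SubStar n r) λ F →
  Disconnected (λ x → ∃ λ i → InSubStar (F i) x)

IsMin : (ℕ → Set) → ℕ → Set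
IsMin P m = P m × (∀ k → P k → m ≤ k)

StructConn : (n r m : ℕ) → Set
StructConn n r m = IsMin (StarCut n r) m

SubstructConn : (n r m : ℕ) → Set
SubstructConn n r m = IsMin (SubStarCut n r) m

-- n > f(r), denominators cleared.
AboveF : (r n : ℕ) → Set
AboveF r n =
  (r % 2 ≡ 1 → (r + 7 < 2 * n) × (r * r + 4 * r + 3 < 8 * n)) ×
  (r % 2 ≡ 0 → (r * r + 2 * r < 8 * n) × (r + 8 < 2 * n)
              × (r * r + 6 * r + 12 < 12 * n))

-- Every vertex of a star lies within distance 1 of its centre.  Call such a
-- closed ball a fault of weight 2 and a single vertex a fault of weight 1.
-- Splitting Q_{m+1} along the first coordinate into two copies of Q_m, a ball
-- centred in one copy meets the other copy in a single vertex, and induction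
-- on m shows: deleting faults of total weight at most m, with every ball
-- centre deleted, leaves Q_{m+1} connected.  Hence k stars with 2k < n never
-- disconnect Q_n, and κ^s(Q_n; K_{1,r}) ≥ ⌈n/2⌉.
--
-- Conversely, cover the coordinates by ⌈n/2⌉ pairs {a, b}.  The star centred
-- at e_a + e_b whose leaves include e_a and e_b contains all neighbours of 0
-- lying in the pair, but neither 0 nor 1, so these stars isolate 0.  This
-- needs only 2 ≤ r ≤ n and n ≥ 4, which is all that n > f(r) is used for.
module Submission where

open import Defs
open import Data.Nat using (ℕ; zero; suc; _+_; _*_; _≤_; _<_; _≤?_; _%_; z≤n; s≤s; ⌈_/2⌉)
open import Data.Nat.Properties
open import Data.Nat.DivMod using (m%n<n)
open import Data.Bool using (Bool; true; false; not)
import Data.Bool.Properties as Boolₚ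
open import Data.Fin using (Fin; zero; suc; inject≤; punchOut)
import Data.Fin.Properties as Finₚ
open import Data.Fin.Permutation using (Permutation′; insert; id; _⟨$⟩ʳ_)
open import Data.Vec using ([]; _∷_; lookup; replicate; updateAt)
open import Data.Vec.Properties
  using (tabulate∘lookup; tabulate-cong; lookup∘updateAt; lookup∘updateAt′;
         updateAt-updateAt-local; updateAt-id; updateAt-commutes; lookup-replicate)
open import Data.List as List using (List; []; _∷_; [_]; _++_; map; concatMap; length)
open import Data.List.Properties using (map-++)
open import Data.Nat.ListAction using (sum)
open import Data.Nat.ListAction.Properties using (sum-++)
open import Data.List.Relation.Unary.Any as Any using (Any; here; there; any?)
import Data.List.Relation.Unary.Any.Properties as Anyₚ
open import Data.List.Relation.Unary.All using (All; []; _∷_)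
import Data.List.Relation.Unary.All.Properties as Allₚ
open import Data.List.Membership.Propositional using (_∈_; _∉_)
open import Data.Product using (∃; _×_; _,_; proj₁; proj₂)
import Data.Product as Product
open import Data.Sum using (_⊎_; inj₁; inj₂; [_,_]′)
open import Data.Unit using (⊤; tt)
open import Function using (_∘_)
open import Function.Bundles using (Injection)
open import Function.Definitions using (Injective)
open import Function.Properties.Inverse using (↔⇒↣)
open import Relation.Binary.PropositionalEquality
  using (_≡_; _≢_; refl; sym; trans; cong; subst)
open import Relation.Nullary using (¬_; yes; no; contradiction)

private
  variable
    m n r k : ℕ

∃∉ : (ks : List (Fin n)) → length ks < n → ∃ λ k → k ∉ ks
∃∉ {n} ks len = Finₚ.¬∀⟶∃¬ n (_∈ ks) (λ k → any? (k Finₚ.≟_) ks) not-all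
  where
  not-all : ¬ (∀ k → k ∈ ks)
  not-all all∈ with i , j , i<j , same ← Finₚ.pigeonhole len (Any.index ∘ all∈) =
    Finₚ.<-irrefl i≡j i<j
    where
    i≡j = trans (Anyₚ.lookup-index (all∈ i))
            (trans (cong (List.lookup ks) same) (sym (Anyₚ.lookup-index (all∈ j))))

lookup-ext : {u v : Vertex n} → (∀ k → lookup u k ≡ lookup v k) → u ≡ v
lookup-ext {u = u} {v} eq =
  trans (sym (tabulate∘lookup u)) (trans (tabulate-cong eq) (tabulate∘lookup v))

flipAt : Vertex n → Fin n → Vertex n
flipAt x j = updateAt x j not

lookup-flipAt : (x : Vertex n) (j : Fin n) → lookup (flipAt x j) j ≡ not (lookup x j)
lookup-flipAt x j = lookup∘updateAt j x

lookup-flipAt-≢ : (x : Vertex n) {j k : Fin n} → k ≢ j → lookup (flipAt x j) k ≡ lookup x k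
lookup-flipAt-≢ x {j} {k} k≢j = lookup∘updateAt′ k j k≢j x

flipAt-involutive : (x : Vertex n) (j : Fin n) → flipAt (flipAt x j) j ≡ x
flipAt-involutive x j =
  trans (updateAt-updateAt-local j x (Boolₚ.not-involutive _)) (updateAt-id j x)

flipAt-comm : (x : Vertex n) {j k : Fin n} → j ≢ k →
              flipAt (flipAt x j) k ≡ flipAt (flipAt x k) j
flipAt-comm x {j} {k} j≢k = updateAt-commutes k j (j≢k ∘ sym) x

flipAt-injective : (x : Vertex n) {j k : Fin n} → flipAt x j ≡ flipAt x k → j ≡ k
flipAt-injective x {j} {k} eq with j Finₚ.≟ k
... | yes j≡k = j≡k
... | no j≢k = contradiction
  (trans (sym (lookup-flipAt x j)) (trans (cong (λ y → lookup y j) eq) (lookup-flipAt-≢ x j≢k)))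
  (Boolₚ.not-¬ refl ∘ sym)

adj-flipAt : (x : Vertex n) (j : Fin n) → Adj x (flipAt x j)
adj-flipAt x j =
  j , (λ eq → Boolₚ.not-¬ refl (trans eq (lookup-flipAt x j))) ,
  λ k k≢j → sym (lookup-flipAt-≢ x k≢j)

adj⇒flipAt : {u v : Vertex n} → Adj u v → ∃ λ j → v ≡ flipAt u j
adj⇒flipAt {u = u} {v} (j , differ , agree) = j , lookup-ext coordinate
  where
  coordinate : ∀ k → lookup v k ≡ lookup (flipAt u j) k
  coordinate k with k Finₚ.≟ j
  ... | yes refl = trans (Boolₚ.¬-not (differ ∘ sym)) (sym (lookup-flipAt u k))
  ... | no k≢j = trans (sym (agree k k≢j)) (sym (lookup-flipAt-≢ u k≢j))

adj-lift : (s : Bool) {u v : Vertex n} → Adj u v → Adj (s ∷ u) (s ∷ v)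
adj-lift s (i , differ , agree) =
  suc i , differ , λ { zero _ → refl ; (suc j) j≢i → agree j (j≢i ∘ cong suc) }

adj-column : {s t : Bool} (x : Vertex n) → s ≢ t → Adj (s ∷ x) (t ∷ x)
adj-column x s≢t = zero , s≢t , λ { zero 0≢0 → contradiction refl 0≢0 ; (suc j) _ → refl }

Near : Vertex n → Vertex n → Set
Near u v = u ≡ v ⊎ Adj u v

near-∷ : {s t : Bool} {c x : Vertex n} → Near (t ∷ c) (s ∷ x) →
         (t ≡ s × Near c x) ⊎ (t ≢ s × c ≡ x)
near-∷ (inj₁ refl) = inj₁ (refl , inj₁ refl)
near-∷ (inj₂ (zero , differ , agree)) = inj₂ (differ , lookup-ext λ k → agree (suc k) λ ())
near-∷ (inj₂ (suc i , differ , agree)) =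
  inj₁ (agree zero (λ ()) ,
        inj₂ (i , differ , λ j j≢i → agree (suc j) (j≢i ∘ Finₚ.suc-injective)))

differ-twice⇒¬near : {u v : Vertex n} {k l : Fin n} → k ≢ l →
  lookup u k ≢ lookup v k → lookup u l ≢ lookup v l → ¬ Near u v
differ-twice⇒¬near k≢l differ-k differ-l (inj₁ refl) = differ-k refl
differ-twice⇒¬near {k = k} {l} k≢l differ-k differ-l (inj₂ (i , _ , agree)) with k Finₚ.≟ i
... | yes refl = differ-l (agree l (k≢l ∘ sym))
... | no k≢i = differ-k (agree k k≢i)

inStar⇒near : ∀ {s} (S : Star n s) {x} → InStar S x → Near (Star.centre S) x
inStar⇒near S (inj₁ eq) = inj₁ eq
inStar⇒near S (inj₂ (j , refl)) = inj₂ (Star.leaf-adj S j)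

Connected : (Vertex n → Set) → Set
Connected X = ∀ u v → ¬ X u → ¬ X v → Reach (λ w → ¬ X w) u v

module _ {P : Vertex n → Set} where

  reach-trans : ∀ {u v w} → Reach P u v → Reach P v w → Reach P u w
  reach-trans p here = p
  reach-trans p (step q adj Pw) = step (reach-trans p q) adj Pw

  reach-from-isolated : ∀ {u w} → (∀ v → Adj u v → ¬ P v) → Reach P u w → w ≡ u
  reach-from-isolated isolated here = refl
  reach-from-isolated isolated (step p adj Pw) with reach-from-isolated isolated p
  ... | refl = contradiction Pw (isolated _ adj)

module _ {P : Vertex (suc m) → Set} where

  reach-lift : ∀ s {u v} → Reach (λ w → P (s ∷ w)) u v → Reach P (s ∷ u) (s ∷ v)
  reach-lift s here = here
  reach-lift s (step p adj Pw) = step (reach-lift s p) (adj-lift s adj) Pw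

  reach-column : ∀ s t x → P (t ∷ x) → Reach P (s ∷ x) (t ∷ x)
  reach-column s t x Ptx with s Boolₚ.≟ t
  ... | yes refl = here
  ... | no s≢t = step here (adj-column x s≢t) Ptx

module _ (X : Vertex (suc m) → Set) where

  connected-via-hub : (h : Vertex m) → (∀ s → Connected (λ w → X (s ∷ w))) →
                      (∀ s → ¬ X (s ∷ h)) → Connected X
  connected-via-hub h double≤suc⇒≤s hub (a ∷ x) (b ∷ y) u∉ v∉ =
    reach-trans (reach-lift a (double≤suc⇒≤s a x h u∉ (hub a)))
      (reach-trans (reach-column a b h (hub b)) (reach-lift b (double≤suc⇒≤s b h y (hub b) v∉)))

  connected-via-half : ∀ s → Connected (λ w → X (s ∷ w)) →
                       (∀ x → X (s ∷ x) → X (not s ∷ x)) → Connected X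
  connected-via-half s half shadow (a ∷ x) (b ∷ y) u∉ v∉ =
    reach-trans (reach-column a s x (across u∉))
      (reach-trans (reach-lift s (half x y (across u∉) (across v∉))) (reach-column s b y v∉))
    where
    across : ∀ {t z} → ¬ X (t ∷ z) → ¬ X (s ∷ z)
    across {t} t∉ with t Boolₚ.≟ s
    ... | yes refl = t∉
    ... | no t≢s = λ Xsz →
      t∉ (subst (λ t′ → X (t′ ∷ _)) (sym (Boolₚ.¬-not t≢s)) (shadow _ Xsz))

-- Faults and their weight

data Fault (n : ℕ) : Set where
  ball point : Vertex n → Fault n

weightᶠ : Fault n → ℕ
weightᶠ (ball _) = 2
weightᶠ (point _) = 1

weight : List (Fault n) → ℕ
weight L = sum (map weightᶠ L)

_covers_ : Fault n → Vertex n → Set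
ball c covers x = Near c x
point p covers x = p ≡ x

Covered : List (Fault n) → Vertex n → Set
Covered L x = Any (_covers x) L

CentredIn : (Vertex n → Set) → Fault n → Set
CentredIn X (ball c) = X c
CentredIn X (point _) = ⊤

side : Fault (suc n) → Bool
side (ball (t ∷ _)) = t
side (point (t ∷ _)) = t

weight-++ : (L M : List (Fault n)) → weight (L ++ M) ≡ weight L + weight M
weight-++ L M = trans (cong sum (map-++ weightᶠ L M)) (sum-++ (map weightᶠ L) (map weightᶠ M))

restrictᶠ : Bool → Fault (suc n) → List (Fault n)
restrictᶠ s (ball (t ∷ c)) with t Boolₚ.≟ s
... | yes _ = [ ball c ]
... | no _ = [ point c ]
restrictᶠ s (point (t ∷ p)) with t Boolₚ.≟ s
... | yes _ = [ point p ]
... | no _ = []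

restrict : Bool → List (Fault (suc n)) → List (Fault n)
restrict s = concatMap (restrictᶠ s)

forget : Fault (suc n) → Fault n
forget (ball (_ ∷ c)) = ball c
forget (point (_ ∷ p)) = point p

weight-restrictᶠ-≤ : ∀ s (f : Fault (suc n)) → weight (restrictᶠ s f) ≤ weightᶠ f
weight-restrictᶠ-≤ s (ball (t ∷ c)) with t Boolₚ.≟ s
... | yes _ = ≤-refl
... | no _ = s≤s z≤n
weight-restrictᶠ-≤ s (point (t ∷ p)) with t Boolₚ.≟ s
... | yes _ = ≤-refl
... | no _ = z≤n

weight-restrictᶠ-< : ∀ s (f : Fault (suc n)) → side f ≢ s → weight (restrictᶠ s f) < weightᶠ f
weight-restrictᶠ-< s (ball (t ∷ c)) t≢s with t Boolₚ.≟ s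
... | yes t≡s = contradiction t≡s t≢s
... | no _ = s≤s (s≤s z≤n)
weight-restrictᶠ-< s (point (t ∷ p)) t≢s with t Boolₚ.≟ s
... | yes t≡s = contradiction t≡s t≢s
... | no _ = s≤s z≤n

weight-restrictᶠ-half : ∀ s (f : Fault (suc n)) → side f ≢ s →
                        2 * weight (restrictᶠ s f) ≤ weightᶠ f
weight-restrictᶠ-half s (ball (t ∷ c)) t≢s with t Boolₚ.≟ s
... | yes t≡s = contradiction t≡s t≢s
... | no _ = ≤-refl
weight-restrictᶠ-half s (point (t ∷ p)) t≢s with t Boolₚ.≟ s
... | yes t≡s = contradiction t≡s t≢s
... | no _ = z≤n

weight-restrict-≤ : ∀ s (L : List (Fault (suc n))) → weight (restrict s L) ≤ weight L
weight-restrict-≤ s [] = z≤n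
weight-restrict-≤ s (f ∷ L) = ≤-trans (≤-reflexive (weight-++ (restrictᶠ s f) (restrict s L)))
  (+-mono-≤ (weight-restrictᶠ-≤ s f) (weight-restrict-≤ s L))

weight-restrict-< : ∀ {s} {L : List (Fault (suc n))} → Any (λ f → side f ≢ s) L →
                    weight (restrict s L) < weight L
weight-restrict-< {s = s} {f ∷ L} (here f≢s) = ≤-<-trans (≤-reflexive (weight-++ (restrictᶠ s f) _))
  (+-mono-<-≤ (weight-restrictᶠ-< s f f≢s) (weight-restrict-≤ s L))
weight-restrict-< {s = s} {f ∷ L} (there away) = ≤-<-trans (≤-reflexive (weight-++ (restrictᶠ s f) _))
  (+-mono-≤-< (weight-restrictᶠ-≤ s f) (weight-restrict-< away))

weight-restrict-half : ∀ {s} {L : List (Fault (suc n))} → All (λ f → side f ≢ s) L →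
                       2 * weight (restrict s L) ≤ weight L
weight-restrict-half [] = z≤n
weight-restrict-half {s = s} {f ∷ L} (f≢s ∷ away) = begin
  2 * weight (restrictᶠ s f ++ restrict s L)
    ≡⟨ cong (2 *_) (weight-++ (restrictᶠ s f) (restrict s L)) ⟩
  2 * (weight (restrictᶠ s f) + weight (restrict s L))
    ≡⟨ *-distribˡ-+ 2 (weight (restrictᶠ s f)) _ ⟩
  2 * weight (restrictᶠ s f) + 2 * weight (restrict s L)
    ≤⟨ +-mono-≤ (weight-restrictᶠ-half s f f≢s) (weight-restrict-half away) ⟩
  weightᶠ f + weight L ∎
  where open ≤-Reasoning

weight-forget : (L : List (Fault (suc n))) → weight (map forget L) ≡ weight L
weight-forget [] = refl
weight-forget (ball (_ ∷ _) ∷ L) = cong (2 +_) (weight-forget L)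
weight-forget (point (_ ∷ _) ∷ L) = cong (1 +_) (weight-forget L)

covered-restrict : ∀ {s} {x : Vertex n} (L : List (Fault (suc n))) →
                   Covered L (s ∷ x) → Covered (restrict s L) x
covered-restrict {s = s} (f ∷ L) (here f-covers) = Anyₚ.++⁺ˡ (covered-restrictᶠ f f-covers)
  where
  covered-restrictᶠ : ∀ {x} f → f covers (s ∷ x) → Covered (restrictᶠ s f) x
  covered-restrictᶠ (ball (t ∷ c)) near with t Boolₚ.≟ s | near-∷ near
  ... | yes _   | inj₁ (_ , near′) = here near′
  ... | yes t≡s | inj₂ (t≢s , _) = contradiction t≡s t≢s
  ... | no t≢s  | inj₁ (t≡s , _) = contradiction t≡s t≢s
  ... | no _    | inj₂ (_ , c≡x) = here c≡x
  covered-restrictᶠ (point (.s ∷ _)) refl with s Boolₚ.≟ s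
  ... | yes _ = here refl
  ... | no s≢s = contradiction refl s≢s
covered-restrict {s = s} (f ∷ L) (there covered) =
  Anyₚ.++⁺ʳ (restrictᶠ s f) (covered-restrict L covered)

covered-forget : ∀ {s} {x : Vertex n} (L : List (Fault (suc n))) →
                 Covered L (s ∷ x) → Covered (map forget L) x
covered-forget L covered = Anyₚ.map⁺ (Any.map forget-covers covered)
  where
  forget-covers : ∀ {s x} {f : Fault (suc _)} → f covers (s ∷ x) → forget f covers x
  forget-covers {f = ball (_ ∷ _)} near with near-∷ near
  ... | inj₁ (_ , near′) = near′
  ... | inj₂ (_ , c≡x) = inj₁ c≡x
  forget-covers {f = point (_ ∷ _)} refl = refl

centred-restrict : ∀ {s} {X : Vertex (suc n) → Set} {L : List (Fault (suc n))} →
  All (CentredIn X) L → All (CentredIn (λ w → X (s ∷ w))) (restrict s L)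
centred-restrict [] = []
centred-restrict {s = s} {X} {f ∷ _} (centred ∷ rest) =
  Allₚ.++⁺ (centred-restrictᶠ f centred) (centred-restrict rest)
  where
  centred-restrictᶠ : ∀ f → CentredIn X f → All (CentredIn (λ w → X (s ∷ w))) (restrictᶠ s f)
  centred-restrictᶠ (ball (t ∷ c)) Xc with t Boolₚ.≟ s
  ... | yes refl = Xc ∷ []
  ... | no _ = tt ∷ []
  centred-restrictᶠ (point (t ∷ p)) _ with t Boolₚ.≟ s
  ... | yes _ = tt ∷ []
  ... | no _ = []

-- A vertex s ∷ x is covered only by a ball centred at not s ∷ x, which is deleted.
shadow : ∀ {s} {X : Vertex (suc n) → Set} {L : List (Fault (suc n))} →
  All (λ f → side f ≢ s) L → All (CentredIn X) L → (∀ x → X x → Covered L x) →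
  ∀ x → X (s ∷ x) → X (not s ∷ x)
shadow {s = s} {X} away centred X⊆L x Xsx = go away centred (X⊆L _ Xsx)
  where
  go : ∀ {L} → All (λ f → side f ≢ s) L → All (CentredIn X) L →
       Covered L (s ∷ x) → X (not s ∷ x)
  go {ball (t ∷ c) ∷ _} (t≢s ∷ _) (Xtc ∷ _) (here near) with near-∷ near
  ... | inj₁ (t≡s , _) = contradiction t≡s t≢s
  ... | inj₂ (_ , refl) = subst (λ t′ → X (t′ ∷ c)) (Boolₚ.¬-not t≢s) Xtc
  go {point (_ ∷ _) ∷ _} (s≢s ∷ _) _ (here refl) = contradiction refl s≢s
  go (_ ∷ away) (_ ∷ centred) (there covered) = go away centred covered

uncovered-vertex : ∀ m (L : List (Fault m)) → weight L ≤ m → ∃ λ v → ¬ Covered L v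
uncovered-vertex m [] _ = replicate m false , λ ()
uncovered-vertex zero (ball _ ∷ _) ()
uncovered-vertex zero (point _ ∷ _) ()
uncovered-vertex (suc m) (f ∷ L) light =
  let s = not (side f)
      lighter = weight-restrict-< {s = s} {f ∷ L} (here (Boolₚ.not-¬ refl))
      v , v∉ = uncovered-vertex m (restrict s (f ∷ L)) (≤-pred (≤-trans lighter light))
  in s ∷ v , v∉ ∘ covered-restrict (f ∷ L)

one-sided⊎two-sided : (L : List (Fault (suc n))) →
  (∃ λ s → All (λ f → side f ≢ s) L) ⊎ (∀ s → Any (λ f → side f ≢ s) L)
one-sided⊎two-sided L
  with any? (λ f → side f Boolₚ.≟ true) L | any? (λ f → side f Boolₚ.≟ false) L
... | no none-true | _ = inj₁ (true , Allₚ.¬Any⇒All¬ L none-true)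
... | yes _ | no none-false = inj₁ (false , Allₚ.¬Any⇒All¬ L none-false)
... | yes some-true | yes some-false =
  inj₂ λ { true → Any.map Boolₚ.not-¬ some-false ; false → Any.map Boolₚ.not-¬ some-true }

double≤suc⇒≤ : ∀ {w} → 2 * w ≤ suc m → w ≤ m
double≤suc⇒≤ {m} {w} 2w≤ with w ≤? m
... | yes w≤m = w≤m
... | no w≰m = contradiction (≤-trans (*-monoʳ-≤ 2 (≰⇒> w≰m)) 2w≤)
                             (<⇒≱ (m<m+n (suc m) (s≤s z≤n)))

light-faults-keep-connected : ∀ m (X : Vertex (suc m) → Set) (L : List (Fault (suc m))) →
  weight L ≤ m → (∀ x → X x → Covered L x) → All (CentredIn X) L → Connected X
light-faults-keep-connected zero X L _ _ _ (a ∷ []) (b ∷ []) _ v∉ = reach-column a b [] v∉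
light-faults-keep-connected (suc m) X L light X⊆L centred =
  [ via-half , via-hub ]′ (one-sided⊎two-sided L)
  where
  half : ∀ s → weight (restrict s L) ≤ m → Connected (λ w → X (s ∷ w))
  half s light′ = light-faults-keep-connected m _ (restrict s L) light′
    (λ x → covered-restrict L ∘ X⊆L _) (centred-restrict centred)

  via-hub : (∀ s → Any (λ f → side f ≢ s) L) → Connected X
  via-hub two-sided = connected-via-hub X (proj₁ hub)
    (λ s → half s (≤-pred (≤-trans (weight-restrict-< (two-sided s)) light)))
    (λ s Xsh → proj₂ hub (covered-forget L (X⊆L _ Xsh)))
    where
    hub = uncovered-vertex (suc m) (map forget L) (≤-trans (≤-reflexive (weight-forget L)) light)

  via-half : (∃ λ s → All (λ f → side f ≢ s) L) → Connected X
  via-half (s , away) = connected-via-half X s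
    (half s (double≤suc⇒≤ (≤-trans (weight-restrict-half away) light)))
    (shadow away centred X⊆L)

-- Lower bound

centreBalls : (Fin k → Vertex n) → List (Fault n)
centreBalls c = List.tabulate (ball ∘ c)

weight-centreBalls : ∀ k (c : Fin k → Vertex n) → weight (centreBalls c) ≡ 2 * k
weight-centreBalls zero c = refl
weight-centreBalls (suc k) c =
  trans (cong (2 +_) (weight-centreBalls k (c ∘ suc))) (sym (*-suc 2 k))

few-subStars-keep-connected : (F : Fin k → SubStar (suc m) r) → 2 * k ≤ m →
  Connected (λ x → ∃ λ i → InSubStar (F i) x)
few-subStars-keep-connected {k} {m} F 2k≤m =
  light-faults-keep-connected m _ (centreBalls centre)
    (≤-trans (≤-reflexive (weight-centreBalls k centre)) 2k≤m)
    (λ x (i , x∈) → Anyₚ.tabulate⁺ i (inStar⇒near (SubStar.star (F i)) x∈))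
    (Allₚ.tabulate⁺ λ i → i , inj₁ refl)
  where
  centre : Fin k → Vertex (suc m)
  centre i = Star.centre (SubStar.star (F i))

⌈/2⌉-≤ : n ≤ 2 * k → ⌈ n /2⌉ ≤ k
⌈/2⌉-≤ {n} {k} n≤2k = ≤-trans (⌈n/2⌉-mono n≤2k)
  (≤-reflexive (trans (cong (λ j → ⌈ k + j /2⌉) (+-identityʳ k)) (sym (n≡⌈n+n/2⌉ k))))

subStarCut-size : SubStarCut n r k → ⌈ n /2⌉ ≤ k
subStarCut-size {zero} _ = z≤n
subStarCut-size {suc m} {k = k} (F , u , v , u∉ , v∉ , u↛v) with suc m ≤? 2 * k
... | yes n≤2k = ⌈/2⌉-≤ n≤2k
... | no n≰2k = contradiction (few-subStars-keep-connected F (≤-pred (≰⇒> n≰2k)) u v u∉ v∉) u↛v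

toSubStar : Star n r → SubStar n r
toSubStar {r = r} S = record { size = r ; size≤ = ≤-refl ; star = S }

starCut-size : StarCut n r k → ⌈ n /2⌉ ≤ k
starCut-size (F , disconnected) = subStarCut-size (toSubStar ∘ F , disconnected)

-- Upper bound

flipStar : ∀ {s} (c : Vertex n) (g : Fin s → Fin n) → Injective _≡_ _≡_ g → Star n s
flipStar c g g-injective = record
  { centre = c
  ; leaf = flipAt c ∘ g
  ; leaf-inj = g-injective ∘ flipAt-injective c
  ; leaf-adj = adj-flipAt c ∘ g
  }

isolating-cut : (F : Fin k → Star n r) (u v : Vertex n) → u ≢ v →
  (∀ w → Adj u w → ∃ λ i → InStar (F i) w) →
  (∀ i → ¬ InStar (F i) u) → (∀ i → ¬ InStar (F i) v) → StarCut n r k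
isolating-cut F u v u≢v around u∉ v∉ =
  F , u , v , (λ (i , u∈) → u∉ i u∈) , (λ (i , v∈) → v∉ i v∈) ,
  λ u↝v → u≢v (sym (reach-from-isolated (λ w adj w∉ → w∉ (around w adj)) u↝v))

far⇒∉star : ∀ {s} (S : Star n s) {x} {k l : Fin n} → k ≢ l →
  lookup (Star.centre S) k ≢ lookup x k → lookup (Star.centre S) l ≢ lookup x l → ¬ InStar S x
far⇒∉star S k≢l differ-k differ-l = differ-twice⇒¬near k≢l differ-k differ-l ∘ inStar⇒near S

0⃗ : Vertex n
0⃗ = replicate _ false

pairCentre : Fin n → Fin n → Vertex n
pairCentre a b = flipAt (flipAt 0⃗ a) b

module _ {a b : Fin n} (a≢b : a ≢ b) where

  pairCentre-a : lookup (pairCentre a b) a ≡ true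
  pairCentre-a = trans (lookup-flipAt-≢ (flipAt 0⃗ a) a≢b)
    (trans (lookup-flipAt 0⃗ a) (cong not (lookup-replicate a false)))

  pairCentre-b : lookup (pairCentre a b) b ≡ true
  pairCentre-b = trans (lookup-flipAt (flipAt 0⃗ a) b)
    (cong not (trans (lookup-flipAt-≢ 0⃗ (a≢b ∘ sym)) (lookup-replicate b false)))

  pairCentre-off : ∀ {k} → k ≢ a → k ≢ b → lookup (pairCentre a b) k ≡ false
  pairCentre-off {k} k≢a k≢b = trans (lookup-flipAt-≢ (flipAt 0⃗ a) k≢b)
    (trans (lookup-flipAt-≢ 0⃗ k≢a) (lookup-replicate k false))

-- A permutation of the coordinates sending 0 ↦ a and 1 ↦ b.
pairPermutation : {a b : Fin (2 + n)} → a ≢ b → Permutation′ (2 + n)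
pairPermutation {a = a} a≢b = insert zero a (insert zero (punchOut a≢b) id)

leafCoordinate : r ≤ n → {a b : Fin (2 + n)} → a ≢ b → Fin (2 + r) → Fin (2 + n)
leafCoordinate r≤n a≢b t = pairPermutation a≢b ⟨$⟩ʳ inject≤ t (s≤s (s≤s r≤n))

leafCoordinate-injective : (r≤n : r ≤ n) {a b : Fin (2 + n)} (a≢b : a ≢ b) →
                           Injective _≡_ _≡_ (leafCoordinate r≤n a≢b)
leafCoordinate-injective r≤n a≢b =
  Finₚ.inject≤-injective _ _ _ _ ∘ Injection.injective (↔⇒↣ (pairPermutation a≢b))

pairStar : r ≤ n → {a b : Fin (2 + n)} → a ≢ b → Star (2 + n) (2 + r)
pairStar r≤n {a} {b} a≢b =
  flipStar (pairCentre a b) (leafCoordinate r≤n a≢b) (leafCoordinate-injective r≤n a≢b)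

module _ (r≤n : r ≤ n) {a b : Fin (2 + n)} (a≢b : a ≢ b) where

  pairStar-∋-a : InStar (pairStar r≤n a≢b) (flipAt 0⃗ a)
  pairStar-∋-a = inj₂ (suc zero , trans (cong (flipAt (pairCentre a b)) (Finₚ.punchIn-punchOut a≢b))
                                        (flipAt-involutive (flipAt 0⃗ a) b))

  pairStar-∋-b : InStar (pairStar r≤n a≢b) (flipAt 0⃗ b)
  pairStar-∋-b = inj₂ (zero , trans (flipAt-comm (flipAt 0⃗ a) (a≢b ∘ sym))
                                    (cong (λ y → flipAt y b) (flipAt-involutive 0⃗ a)))

  pairStar-∌-0⃗ : ¬ InStar (pairStar r≤n a≢b) 0⃗
  pairStar-∌-0⃗ = far⇒∉star (pairStar r≤n a≢b) a≢b
    (λ eq → contradiction (trans (sym (pairCentre-a a≢b)) (trans eq (lookup-replicate a false))) λ ())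
    (λ eq → contradiction (trans (sym (pairCentre-b a≢b)) (trans eq (lookup-replicate b false))) λ ())

  pairStar-∌-1⃗ : 2 ≤ n → ¬ InStar (pairStar r≤n a≢b) (replicate _ true)
  pairStar-∌-1⃗ 2≤n with ∃∉ (a ∷ b ∷ []) (s≤s (s≤s (≤-trans (s≤s z≤n) 2≤n)))
  ... | k , k∉ with ∃∉ (a ∷ b ∷ k ∷ []) (s≤s (s≤s 2≤n))
  ... | l , l∉ = far⇒∉star (pairStar r≤n a≢b) (λ k≡l → l∉ (there (there (here (sym k≡l)))))
    (off k (k∉ ∘ here) (k∉ ∘ there ∘ here)) (off l (l∉ ∘ here) (l∉ ∘ there ∘ here))
    where
    off : ∀ j → j ≢ a → j ≢ b → lookup (pairCentre a b) j ≢ lookup (replicate (2 + n) true) j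
    off j j≢a j≢b eq = contradiction
      (trans (sym (pairCentre-off a≢b j≢a j≢b)) (trans eq (lookup-replicate j true))) λ ()

-- Pairs {0,1}, {2,3}, …; in odd dimension d the last pair is {d-2, d-1}.
pairing : ∀ n → Fin ⌈ 2 + n /2⌉ → Fin (2 + n) × Fin (2 + n)
pairing n zero = zero , suc zero
pairing zero (suc ())
pairing (suc zero) (suc zero) = suc zero , suc (suc zero)
pairing (suc zero) (suc (suc ()))
pairing (suc (suc n)) (suc i) = Product.map shift shift (pairing n i)
  where
  shift : Fin (2 + n) → Fin (4 + n)
  shift j = suc (suc j)

pairing-distinct : ∀ n i → proj₁ (pairing n i) ≢ proj₂ (pairing n i)
pairing-distinct n zero ()
pairing-distinct (suc zero) (suc zero) ()
pairing-distinct (suc (suc n)) (suc i) eq =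
  pairing-distinct n i (Finₚ.suc-injective (Finₚ.suc-injective eq))

pairing-covers : ∀ n (j : Fin (2 + n)) →
                 ∃ λ i → proj₁ (pairing n i) ≡ j ⊎ proj₂ (pairing n i) ≡ j
pairing-covers n zero = zero , inj₁ refl
pairing-covers n (suc zero) = zero , inj₂ refl
pairing-covers (suc zero) (suc (suc zero)) = suc zero , inj₂ refl
pairing-covers (suc (suc n)) (suc (suc j)) with pairing-covers n j
... | i , inj₁ refl = suc i , inj₁ refl
... | i , inj₂ refl = suc i , inj₂ refl

pairStars-cut : r ≤ n → 2 ≤ n → StarCut (2 + n) (2 + r) ⌈ 2 + n /2⌉
pairStars-cut {n = n} r≤n 2≤n =
  isolating-cut star 0⃗ (replicate _ true) (λ ()) around
    (λ i → pairStar-∌-0⃗ r≤n (pairing-distinct n i))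
    (λ i → pairStar-∌-1⃗ r≤n (pairing-distinct n i) 2≤n)
  where
  star : Fin ⌈ 2 + n /2⌉ → Star (2 + n) _
  star i = pairStar r≤n (pairing-distinct n i)

  around : ∀ w → Adj 0⃗ w → ∃ λ i → InStar (star i) w
  around w adj with adj⇒flipAt {u = 0⃗} {w} adj
  ... | j , refl with pairing-covers n j
  ...   | i , inj₁ refl = i , pairStar-∋-a r≤n (pairing-distinct n i)
  ...   | i , inj₂ refl = i , pairStar-∋-b r≤n (pairing-distinct n i)

parity : ∀ r → r % 2 ≡ 0 ⊎ r % 2 ≡ 1
parity r with r % 2 | m%n<n r 2
... | 0 | _ = inj₁ refl
... | 1 | _ = inj₂ refl
... | suc (suc _) | s≤s (s≤s ())

aboveF-weaken : AboveF r n → r + 7 < 2 * n × r * r < 8 * n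
aboveF-weaken {r} (odd , even) with parity r
... | inj₂ r-odd with odd r-odd
...   | lin , quad = lin , ≤-<-trans (≤-trans (m≤m+n (r * r) (4 * r)) (m≤m+n _ 3)) quad
aboveF-weaken {r} (odd , even) | inj₁ r-even with even r-even
...   | quad , lin , _ = ≤-<-trans (+-monoʳ-≤ r (n≤1+n 7)) lin , ≤-<-trans (m≤m+n (r * r) (2 * r)) quad

-- If n < r then r > 7, so r² ≥ 8r > 8n.
bounds⇒r≤n : r + 7 < 2 * n → r * r < 8 * n → r ≤ n
bounds⇒r≤n {r} {n} lin quad with r ≤? n
... | yes r≤n = r≤n
... | no r≰n = contradiction quad (≤⇒≯ (≤-trans (*-monoʳ-≤ 8 (<⇒≤ n<r)) (*-monoˡ-≤ r 8≤r)))
  where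
  n<r = ≰⇒> r≰n
  8≤r : 8 ≤ r
  8≤r = +-cancelˡ-< r 7 r (<-≤-trans lin (≤-trans (*-monoʳ-≤ 2 (<⇒≤ n<r))
          (≤-reflexive (cong (r +_) (+-identityʳ r)))))

bound⇒4≤n : r + 7 < 2 * n → 4 ≤ n
bound⇒4≤n {r} lin = *-cancelˡ-≤ 2 (≤-trans (s≤s (m≤n+m 7 r)) lin)

upper-cut : 2 ≤ r → r ≤ n → 4 ≤ n → StarCut n r ⌈ n /2⌉
upper-cut (s≤s (s≤s z≤n)) (s≤s (s≤s r≤n)) (s≤s (s≤s 2≤n)) = pairStars-cut r≤n 2≤n

theorem3p13 : (r n : ℕ) → 2 ≤ r → AboveF r n →
    StructConn n r ⌈ n /2⌉ × SubstructConn n r ⌈ n /2⌉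
theorem3p13 r n 2≤r above =
  (cut , λ _ → starCut-size) , ((toSubStar ∘ proj₁ cut , proj₂ cut) , λ _ → subStarCut-size)
  where
  bounds : r + 7 < 2 * n × r * r < 8 * n
  bounds = aboveF-weaken {r = r} {n = n} above

  cut : StarCut n r ⌈ n /2⌉
  cut = upper-cut 2≤r (bounds⇒r≤n (proj₁ bounds) (proj₂ bounds)) (bound⇒4≤n (proj₁ bounds))
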